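{- Let $\Sigma\cup\{x|y\}$ be a finite set of exclusion atoms. Then the problem of deciding whether $\Sigma\vdash x|y$ is decidable.
   Context: Finite tuples of variables (repetitions allowed) are written $x,y,u,v,\dots$; $|x|$ is the length and juxtaposition denotes concatenation. An exclusion atom is an expression $x|y$ with $|x|=|y|$ (semantically, a team $T$ — a finite set of assignments of values to variables — satisfies it iff $s_1(x)\neq s_2(y)$ for all $s_1,s_2\in T$). Rules (schemata over tuples making the atoms well formed): (E1) $x|x\vdash y|z$; (E2) $x|y\vdash y|x$; (E3) $x|y\vdash xu|yv$; (E4) $xuu|yvv\vdash xu|yv$; (E5) $xyz|uvw\vdash xzy|uwv$ where $|x|=|u|$, $|y|=|v|$; (E6) $xw|yw\vdash zz|xy$. $\Sigma\vdash x|y$ means $x|y$ is derivable from atoms of $\Sigma$ by finitely many applications of these rules. -}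

module Defs where

open import Data.Nat using (ℕ)
open import Data.List using (List; length; _++_)
open import Data.List.Membership.Propositional using (_∈_)
open import Data.Product using (_×_; _,_)
open import Relation.Binary.PropositionalEquality using (_≡_)

Var : Set
Var = ℕ

Tuple : Set
Tuple = List Var

record Atom : Set where
  constructor _∣_
  field
    lhs : Tuple
    rhs : Tuple

WF : Atom → Set
WF (x ∣ y) = length x ≡ length y

-- Derivability Σ ⊢ a by rules (E1)-(E6).  Side conditions ensure that every
-- instance of a rule schema consists of well-formed atoms (premises are
-- derived, hence well formed whenever Σ is).
infix 4 _⊢_
data _⊢_ (Σ : List Atom) : Atom → Set where
  hyp : ∀ {a} → a ∈ Σ → Σ ⊢ a
  E1  : ∀ {x y z} → length y ≡ length z →
        Σ ⊢ x ∣ x → Σ ⊢ y ∣ z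
  E2  : ∀ {x y} → Σ ⊢ x ∣ y → Σ ⊢ y ∣ x
  E3  : ∀ {x y u v} → length u ≡ length v →
        Σ ⊢ x ∣ y → Σ ⊢ (x ++ u) ∣ (y ++ v)
  E4  : ∀ {x y u v} → length x ≡ length y → length u ≡ length v →
        Σ ⊢ (x ++ u ++ u) ∣ (y ++ v ++ v) → Σ ⊢ (x ++ u) ∣ (y ++ v)
  E5  : ∀ {x y z u v w} → length x ≡ length u → length y ≡ length v →
        Σ ⊢ (x ++ y ++ z) ∣ (u ++ v ++ w) → Σ ⊢ (x ++ z ++ y) ∣ (u ++ w ++ v)
  E6  : ∀ {x y w z} → length z ≡ length x →
        Σ ⊢ (x ++ w) ∣ (y ++ w) → Σ ⊢ (z ++ z) ∣ (x ++ y)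

-- Σ ⊢ a holds iff a single atom σ ∈ Σ yields a: on one side of a (or of its
-- mirror image), either every column of σ is a column of a, or the two entries
-- of every column of σ are connected, two values being linked when they sit in
-- columns of a that share their entry on the other side.
--
-- Soundness: E3–E5 only add, duplicate or permute columns and E2 mirrors, while
-- E1 and E6 push everything into the connected case, because every column of
-- x|x, resp. of xw|yw, is connected in the conclusion.  Completeness: with
-- E3–E5 one may pass to any atom with more columns, and E6 turns an atom each of
-- whose columns (p,q) is diagonal or has a z with (z,p) and (z,q) in R into one
-- all of whose columns are in R.  Iterating this down the stages of the
-- connectivity relation leads from σ to a.  The criterion only involves the
-- finitely many values occurring in Σ and a, so it is decidable.
module Submission where

open import Data.List.Base using (List; []; _∷_; [_]; _++_; length; map; zip; unzip)
open import Data.List.Properties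
  using (length-++; unzip-zip; unzipWith-++; length-unzipWith₁; length-unzipWith₂; zip-flip)
open import Data.List.Membership.Propositional using (_∈_; find; lose)
open import Data.List.Membership.Propositional.Properties
  using (∈-++⁺ˡ; ∈-++⁺ʳ; ∈-++⁻; ∈-∃++; ∈-map⁺)
import Data.List.Membership.DecPropositional as DecMembership
open import Data.List.Relation.Binary.Subset.Propositional using (_⊆_)
open import Data.List.Relation.Binary.Subset.Propositional.Properties
  using (⊆-reflexive; ⊆-trans; ⊆-reflexive-↭; xs⊆xs++ys; ++⁺ʳ; ∷⁺ʳ)
open import Data.List.Relation.Binary.Permutation.Propositional.Properties using (++-comm)
open import Data.List.Relation.Unary.All as All using (All; []; _∷_; all?)
open import Data.List.Relation.Unary.All.Properties using () renaming (++⁺ to All-++⁺)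
open import Data.List.Relation.Unary.Any as Any using (Any; here; there; any?)
open import Data.Nat.Base using (ℕ; zero; suc; _+_; _⊔_; _≤′_; ≤′-refl; ≤′-step)
open import Data.Nat.Properties
  using (_≟_; suc-injective; +-cancelˡ-≡; +-cancelʳ-≡; ≤⇒≤′; z≤′n; m≤m⊔n; m≤n⊔m)
open import Data.Product.Base using (∃; _×_; _,_; proj₁; proj₂; uncurry; swap)
open import Data.Product.Properties using (≡-dec)
open import Data.Sum.Base using (_⊎_; inj₁; inj₂; [_,_]′) renaming (swap to ⊎-swap)
open import Function.Base using (_∘_; id)
open import Function.Bundles using (_⇔_; mk⇔)
open import Level using (0ℓ)
open import Relation.Binary.Core using (Rel; _⇒_)
open import Relation.Binary.Definitions using (Reflexive; Symmetric; Decidable; DecidableEquality)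
open import Relation.Binary.Construct.Closure.ReflexiveTransitive as Star using (Star; ε; _◅_; _◅◅_; _⋆)
open import Relation.Binary.PropositionalEquality.Core using (_≡_; refl; sym; trans; cong; cong₂; subst)
open import Relation.Binary.PropositionalEquality.Properties using (module ≡-Reasoning)
open import Relation.Nullary.Decidable as Dec using (Dec; map′; _×-dec_; _⊎-dec_)

open import Defs
open Atom

module _ {A B : Set} (x : List A) (u : List A) (y : List B) (v : List B) where

  length-++-cong : length x ≡ length y → length u ≡ length v → length (x ++ u) ≡ length (y ++ v)
  length-++-cong p q = begin
    length (x ++ u)     ≡⟨ length-++ x ⟩
    length x + length u ≡⟨ cong₂ _+_ p q ⟩
    length y + length v ≡⟨ sym (length-++ y) ⟩
    length (y ++ v)     ∎
    where open ≡-Reasoning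

  length-++-cancelˡ : length x ≡ length y → length (x ++ u) ≡ length (y ++ v) → length u ≡ length v
  length-++-cancelˡ p e = +-cancelˡ-≡ (length x) _ _ (begin
    length x + length u ≡⟨ sym (length-++ x) ⟩
    length (x ++ u)     ≡⟨ e ⟩
    length (y ++ v)     ≡⟨ length-++ y ⟩
    length y + length v ≡⟨ cong (_+ length v) (sym p) ⟩
    length x + length v ∎)
    where open ≡-Reasoning

  length-++-cancelʳ : length u ≡ length v → length (x ++ u) ≡ length (y ++ v) → length x ≡ length y
  length-++-cancelʳ p e = +-cancelʳ-≡ (length u) _ _ (begin
    length x + length u ≡⟨ sym (length-++ x) ⟩
    length (x ++ u)     ≡⟨ e ⟩
    length (y ++ v)     ≡⟨ length-++ y ⟩
    length y + length v ≡⟨ cong (length y +_) (sym p) ⟩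
    length y + length u ∎)
    where open ≡-Reasoning

module _ {A B : Set} where

  zip-++ : ∀ (x : List A) (y : List B) {u v} →
           length x ≡ length y → zip (x ++ u) (y ++ v) ≡ zip x y ++ zip u v
  zip-++ []      []      e = refl
  zip-++ (a ∷ x) (b ∷ y) e = cong ((a , b) ∷_) (zip-++ x y (suc-injective e))

  zip-++₃ : ∀ (x y z : List A) (u v w : List B) → length x ≡ length u → length y ≡ length v →
            zip (x ++ y ++ z) (u ++ v ++ w) ≡ zip x u ++ zip y v ++ zip z w
  zip-++₃ x y z u v w e₁ e₂ = trans (zip-++ x u e₁) (cong (zip x u ++_) (zip-++ y v e₂))

  ∈-zip-swap : ∀ (x : List A) (y : List B) {c} → c ∈ zip x y → swap c ∈ zip y x
  ∈-zip-swap x y {c} m = subst (swap c ∈_) (sym (zip-flip y x)) (∈-map⁺ swap m)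

  ∈-zip-common : ∀ {C : Set} (x : List A) (y : List B) (z : List C) {a b} → length z ≡ length x →
                 (a , b) ∈ zip x y → ∃ λ c → (c , a) ∈ zip z x × (c , b) ∈ zip z y
  ∈-zip-common (a ∷ x) (b ∷ y) (c ∷ z) e (here refl) = c , here refl , here refl
  ∈-zip-common (a ∷ x) (b ∷ y) (c ∷ z) e (there m) =
    let d , da , db = ∈-zip-common x y z (suc-injective e) m in d , there da , there db

∈-zip-diagonal : ∀ {A : Set} (x : List A) {a b} → (a , b) ∈ zip x x → a ≡ b
∈-zip-diagonal (c ∷ x) (here refl) = refl
∈-zip-diagonal (c ∷ x) (there m)   = ∈-zip-diagonal x m

Column : Set
Column = Var × Var

columns : Atom → List Column
columns (x ∣ y) = zip x y

mirror : Atom → Atom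
mirror (x ∣ y) = y ∣ x

∈-columns-mirror : ∀ a {c} → c ∈ columns a → swap c ∈ columns (mirror a)
∈-columns-mirror (x ∣ y) = ∈-zip-swap x y

lefts rights : List Column → Tuple
lefts  = proj₁ ∘ unzip
rights = proj₂ ∘ unzip

⟦_⟧ : List Column → Atom
⟦ cs ⟧ = lefts cs ∣ rights cs

⟦⟧-WF : ∀ cs → WF ⟦ cs ⟧
⟦⟧-WF cs = trans (length-unzipWith₁ id cs) (sym (length-unzipWith₂ id cs))

⟦⟧-++ : ∀ cs ds → ⟦ cs ++ ds ⟧ ≡ (lefts cs ++ lefts ds) ∣ (rights cs ++ rights ds)
⟦⟧-++ cs ds = cong (uncurry _∣_) (unzipWith-++ id cs ds)

⟦⟧-++₃ : ∀ cs ds es → ⟦ cs ++ ds ++ es ⟧ ≡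
         (lefts cs ++ lefts ds ++ lefts es) ∣ (rights cs ++ rights ds ++ rights es)
⟦⟧-++₃ cs ds es = trans (⟦⟧-++ cs (ds ++ es))
  (cong (λ a → (lefts cs ++ lhs a) ∣ (rights cs ++ rhs a)) (⟦⟧-++ ds es))

⟦columns⟧ : ∀ a → WF a → ⟦ columns a ⟧ ≡ a
⟦columns⟧ (x ∣ y) e = cong (uncurry _∣_) (unzip-zip x y e)

Occurs : List Column → Rel Var 0ℓ
Occurs cs a b = (a , b) ∈ cs

record Linked (R : Rel Var 0ℓ) (p q : Var) : Set where
  constructor linked
  field
    {hub} : Var
    hub-p : R hub p
    hub-q : R hub q

Linked-sym : ∀ {R} → Symmetric (Linked R)
Linked-sym (linked zp zq) = linked zq zp

Linked-mono : ∀ {R S} → R ⇒ S → Linked R ⇒ Linked S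
Linked-mono f (linked zp zq) = linked (f zp) (f zq)

Linked-target : ∀ cs {p q} → Linked (Occurs cs) p q → q ∈ map proj₂ cs
Linked-target cs (linked _ zq) = ∈-map⁺ proj₂ zq

Connected : List Column → Rel Var 0ℓ
Connected cs = Star (Linked (Occurs cs))

Connected-sym : ∀ {cs} → Symmetric (Connected cs)
Connected-sym = Star.reverse Linked-sym

Linked⇒Connected : ∀ {R cs} → R ⇒ Connected cs → Linked R ⇒ Connected cs
Linked⇒Connected h (linked zp zq) = Connected-sym (h zp) ◅◅ h zq

Step : Rel Var 0ℓ → Rel Var 0ℓ
Step R p q = p ≡ q ⊎ Linked R p q

Step-refl : ∀ {R} → Reflexive (Step R)
Step-refl = inj₁ refl

Step-sym : ∀ {R} → Symmetric (Step R)
Step-sym (inj₁ e) = inj₁ (sym e)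
Step-sym (inj₂ l) = inj₂ (Linked-sym l)

Step-inflate : ∀ {R} → Reflexive R → R ⇒ Step R
Step-inflate r pq = inj₂ (linked r pq)

Step-trans : ∀ {R p q r} → Symmetric R → R p q → R q r → Step R p r
Step-trans R-sym pq qr = inj₂ (linked (R-sym pq) qr)

-- The union of the stages is the equivalence closure of Level cs 0, and E6
-- turns an atom whose columns lie in Level cs (suc n) into one whose columns lie
-- in Level cs n.
Level : List Column → ℕ → Rel Var 0ℓ
Level cs zero    = Step (Occurs cs)
Level cs (suc n) = Step (Level cs n)

module _ {cs : List Column} where

  Level-refl : ∀ n → Reflexive (Level cs n)
  Level-refl zero    = Step-refl
  Level-refl (suc n) = Step-refl

  Level-sym : ∀ n → Symmetric (Level cs n)
  Level-sym zero    = Step-sym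
  Level-sym (suc n) = Step-sym

  Level-mono : ∀ {m n} → m ≤′ n → Level cs m ⇒ Level cs n
  Level-mono ≤′-refl           l = l
  Level-mono (≤′-step {n} m≤n) l = Step-inflate (Level-refl n) (Level-mono m≤n l)

  Connected⇒Level : ∀ {p q} → Connected cs p q → ∃ λ n → Level cs n p q
  Connected⇒Level ε = zero , Step-refl
  Connected⇒Level (l ◅ path) =
    let n , r = Connected⇒Level path
    in suc n , Step-trans (Level-sym n) (Level-mono {0} {n} z≤′n (inj₂ l)) r

  Connected⇒Level-All : ∀ {ds} → All (uncurry (Connected cs)) ds →
                        ∃ λ n → All (uncurry (Level cs n)) ds
  Connected⇒Level-All []       = zero , []
  Connected⇒Level-All (path ∷ paths) =
    let m , l  = Connected⇒Level path
        n , ls = Connected⇒Level-All paths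
    in m ⊔ n , Level-mono (≤⇒≤′ (m≤m⊔n m n)) l
            ∷ All.map (Level-mono (≤⇒≤′ (m≤n⊔m m n))) ls

Embeds Joins Shape Yields : Atom → Atom → Set
Embeds σ a = All (_∈ columns a) (columns σ)
Joins  σ a = All (uncurry (Connected (columns a))) (columns σ)
Shape  σ a = Embeds σ a ⊎ Joins σ a
Yields σ a = Shape σ a ⊎ Shape σ (mirror a)

Yields-refl : ∀ a → Yields a a
Yields-refl a = inj₁ (inj₁ (All.tabulate id))

Yields-mirror : ∀ {σ a} → Yields σ a → Yields σ (mirror a)
Yields-mirror = ⊎-swap

Shape-⊆ : ∀ {σ a b} → columns a ⊆ columns b → Shape σ a → Shape σ b
Shape-⊆ a⊆b (inj₁ e) = inj₁ (All.map a⊆b e)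
Shape-⊆ a⊆b (inj₂ j) = inj₂ (All.map (Star.map (Linked-mono a⊆b)) j)

Yields-⊆ : ∀ {σ a b} → columns a ⊆ columns b → Yields σ a → Yields σ b
Yields-⊆ a⊆b (inj₁ s) = inj₁ (Shape-⊆ a⊆b s)
Yields-⊆ {a = a} {b} a⊆b (inj₂ s) =
  inj₂ (Shape-⊆ (λ m → ∈-columns-mirror b (a⊆b (∈-columns-mirror (mirror a) m))) s)

Shape-joined : ∀ {σ a b} → Occurs (columns a) ⇒ Connected (columns b) → Shape σ a → Joins σ b
Shape-joined h (inj₁ e) = All.map h e
Shape-joined h (inj₂ j) = All.map (Linked⇒Connected h ⋆) j

-- Connected (columns b) is an equivalence relation, so once it contains the
-- columns of a it also contains the links on either side of a.
Yields-joined : ∀ {σ a b} → Occurs (columns a) ⇒ Connected (columns b) → Yields σ a → Yields σ b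
Yields-joined h (inj₁ s) = inj₁ (inj₂ (Shape-joined h s))
Yields-joined {a = a} h (inj₂ s) =
  inj₁ (inj₂ (Shape-joined (λ m → Connected-sym (h (∈-columns-mirror (mirror a) m))) s))

diagonal-connected : ∀ x {cs} → Occurs (zip x x) ⇒ Connected cs
diagonal-connected x m rewrite ∈-zip-diagonal x m = ε

-- A column (xᵢ, yᵢ) of the premise is linked in the conclusion through zᵢ.
E6-connected : ∀ (x y z w : Tuple) → length z ≡ length x → length x ≡ length y →
               Occurs (columns ((x ++ w) ∣ (y ++ w))) ⇒ Connected (columns ((z ++ z) ∣ (x ++ y)))
E6-connected x y z w zx xy {a} {b} m
  with ∈-++⁻ (zip x y) (subst ((a , b) ∈_) (zip-++ x y xy) m)
... | inj₂ diagonal = diagonal-connected w diagonal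
... | inj₁ column   =
  let c , ca , cb = ∈-zip-common x y z zx column
      conclusion  = sym (zip-++ z x zx)
  in linked (subst ((c , a) ∈_) conclusion (∈-++⁺ˡ ca))
            (subst ((c , b) ∈_) conclusion (∈-++⁺ʳ (zip z x) cb)) ◅ ε

E5-length : ∀ (x y z u v w : Tuple) → length x ≡ length u → length y ≡ length v →
            length (x ++ y ++ z) ≡ length (u ++ v ++ w) → length z ≡ length w
E5-length x y z u v w e₁ e₂ e =
  length-++-cancelˡ y z v w e₂ (length-++-cancelˡ x (y ++ z) u (v ++ w) e₁ e)

E6-length : ∀ (x y w : Tuple) → length (x ++ w) ≡ length (y ++ w) → length x ≡ length y
E6-length x y w = length-++-cancelʳ x w y w refl

⊢-WF : ∀ {Γ a} → All WF Γ → Γ ⊢ a → WF a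
⊢-WF wfΓ (hyp m)     = All.lookup wfΓ m
⊢-WF wfΓ (E1 e _)    = e
⊢-WF wfΓ (E2 d)      = sym (⊢-WF wfΓ d)
⊢-WF wfΓ (E3 {x} {y} {u} {v} e d) = length-++-cong x u y v (⊢-WF wfΓ d) e
⊢-WF wfΓ (E4 {x} {y} {u} {v} e₁ e₂ _) = length-++-cong x u y v e₁ e₂
⊢-WF wfΓ (E5 {x} {y} {z} {u} {v} {w} e₁ e₂ d) =
  length-++-cong x (z ++ y) u (w ++ v) e₁
    (length-++-cong z y w v (E5-length x y z u v w e₁ e₂ (⊢-WF wfΓ d)) e₂)
⊢-WF wfΓ (E6 {x} {y} {w} {z} e d) =
  length-++-cong z z x y e (trans e (E6-length x y w (⊢-WF wfΓ d)))

E3-columns : ∀ (x y u v : Tuple) → length x ≡ length y → zip x y ⊆ zip (x ++ u) (y ++ v)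
E3-columns x y u v e = ⊆-trans (xs⊆xs++ys (zip x y) (zip u v)) (⊆-reflexive (sym (zip-++ x y e)))

E4-columns : ∀ (x y u v : Tuple) → length x ≡ length y → length u ≡ length v →
             zip (x ++ u ++ u) (y ++ v ++ v) ⊆ zip (x ++ u) (y ++ v)
E4-columns x y u v e₁ e₂ =
  ⊆-trans (⊆-reflexive (zip-++₃ x u u y v v e₁ e₂))
  (⊆-trans (++⁺ʳ (zip x y) (λ m → [ id , id ]′ (∈-++⁻ (zip u v) m)))
           (⊆-reflexive (sym (zip-++ x y e₁))))

E5-columns : ∀ (x y z u v w : Tuple) →
             length x ≡ length u → length y ≡ length v → length z ≡ length w →
             zip (x ++ y ++ z) (u ++ v ++ w) ⊆ zip (x ++ z ++ y) (u ++ w ++ v)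
E5-columns x y z u v w e₁ e₂ e₃ =
  ⊆-trans (⊆-reflexive (zip-++₃ x y z u v w e₁ e₂))
  (⊆-trans (++⁺ʳ (zip x u) (⊆-reflexive-↭ (++-comm (zip y v) (zip z w))))
           (⊆-reflexive (sym (zip-++₃ x z y u w v e₁ e₃))))

sound : ∀ {Γ a} → All WF Γ → Γ ⊢ a → Any (λ σ → Yields σ a) Γ
sound wfΓ (hyp {a} m) = Any.map (λ { refl → Yields-refl a }) m
sound wfΓ (E1 {x} _ d) = Any.map (Yields-joined (diagonal-connected x)) (sound wfΓ d)
sound wfΓ (E2 d) = Any.map Yields-mirror (sound wfΓ d)
sound wfΓ (E3 {x} {y} {u} {v} _ d) =
  Any.map (Yields-⊆ (E3-columns x y u v (⊢-WF wfΓ d))) (sound wfΓ d)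
sound wfΓ (E4 {x} {y} {u} {v} e₁ e₂ d) =
  Any.map (Yields-⊆ (E4-columns x y u v e₁ e₂)) (sound wfΓ d)
sound wfΓ (E5 {x} {y} {z} {u} {v} {w} e₁ e₂ d) =
  Any.map (Yields-⊆ (E5-columns x y z u v w e₁ e₂ (E5-length x y z u v w e₁ e₂ (⊢-WF wfΓ d))))
          (sound wfΓ d)
sound wfΓ (E6 {x} {y} {w} {z} e d) =
  Any.map (Yields-joined (E6-connected x y z w e (E6-length x y w (⊢-WF wfΓ d))))
          (sound wfΓ d)

record E6Cover (R : Rel Var 0ℓ) (cs : List Column) : Set where
  field
    x y z w : Tuple
    z-fits  : length z ≡ length x
    x-fits  : length x ≡ length y
    covers  : cs ⊆ zip x y ++ zip w w
    left    : All (uncurry R) (zip z x)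
    right   : All (uncurry R) (zip z y)

E6-cover : ∀ {R} cs → All (uncurry (Step R)) cs → E6Cover R cs
E6-cover [] [] = record
  { x = []; y = []; z = []; w = []; z-fits = refl; x-fits = refl
  ; covers = λ (); left = []; right = [] }
E6-cover ((p , _) ∷ cs) (inj₁ refl ∷ steps) = record
  { x = x; y = y; z = z; w = p ∷ w; z-fits = z-fits; x-fits = x-fits
  ; covers = λ { (here refl) → ∈-++⁺ʳ (zip x y) (here refl)
               ; (there m)   → ++⁺ʳ (zip x y) there (covers m) }
  ; left = left; right = right }
  where open E6Cover (E6-cover cs steps)
E6-cover ((p , q) ∷ cs) (inj₂ (linked rp rq) ∷ steps) = record
  { x = p ∷ x; y = q ∷ y; z = _ ∷ z; w = w
  ; z-fits = cong suc z-fits; x-fits = cong suc x-fits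
  ; covers = ∷⁺ʳ (p , q) covers; left = rp ∷ left; right = rq ∷ right }
  where open E6Cover (E6-cover cs steps)

module Completeness (Γ : List Atom) where

  cast : ∀ {a b} → a ≡ b → Γ ⊢ a → Γ ⊢ b
  cast = subst (Γ ⊢_)

  E3ᶜ : ∀ cs ds → Γ ⊢ ⟦ cs ⟧ → Γ ⊢ ⟦ cs ++ ds ⟧
  E3ᶜ cs ds d = cast (sym (⟦⟧-++ cs ds))
    (E3 {x = lefts cs} {y = rights cs} {u = lefts ds} {v = rights ds} (⟦⟧-WF ds) d)

  E4ᶜ : ∀ cs ds → Γ ⊢ ⟦ cs ++ ds ++ ds ⟧ → Γ ⊢ ⟦ cs ++ ds ⟧
  E4ᶜ cs ds d = cast (sym (⟦⟧-++ cs ds))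
    (E4 {x = lefts cs} {y = rights cs} {u = lefts ds} {v = rights ds}
        (⟦⟧-WF cs) (⟦⟧-WF ds) (cast (⟦⟧-++₃ cs ds ds) d))

  E5ᶜ : ∀ cs ds es → Γ ⊢ ⟦ cs ++ ds ++ es ⟧ → Γ ⊢ ⟦ cs ++ es ++ ds ⟧
  E5ᶜ cs ds es d = cast (sym (⟦⟧-++₃ cs es ds))
    (E5 {x = lefts cs} {y = lefts ds} {z = lefts es} {u = rights cs} {v = rights ds} {w = rights es}
        (⟦⟧-WF cs) (⟦⟧-WF ds) (cast (⟦⟧-++₃ cs ds es) d))

  rotate : ∀ cs ds → Γ ⊢ ⟦ cs ++ ds ⟧ → Γ ⊢ ⟦ ds ++ cs ⟧
  rotate = E5ᶜ []

  contract : ∀ c cs → Γ ⊢ ⟦ c ∷ c ∷ cs ⟧ → Γ ⊢ ⟦ c ∷ cs ⟧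
  contract c cs d = rotate cs [ c ] (E4ᶜ cs [ c ] (rotate (c ∷ c ∷ []) cs d))

  drop-duplicate : ∀ {c cs} → c ∈ cs → Γ ⊢ ⟦ c ∷ cs ⟧ → Γ ⊢ ⟦ cs ⟧
  drop-duplicate {c} m d with ys , zs , refl ← ∈-∃++ m =
    rotate (c ∷ zs) ys (contract c (zs ++ ys) (E5ᶜ [ c ] ys (c ∷ zs) d))

  absorb : ∀ cs {ds} → cs ⊆ ds → Γ ⊢ ⟦ cs ++ ds ⟧ → Γ ⊢ ⟦ ds ⟧
  absorb []       _   d = d
  absorb (c ∷ cs) sub d = absorb cs (sub ∘ there) (drop-duplicate (∈-++⁺ʳ cs (sub (here refl))) d)

  weaken : ∀ {a b} → WF a → WF b → columns a ⊆ columns b → Γ ⊢ a → Γ ⊢ b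
  weaken {a} {b} wa wb sub d =
    cast (⟦columns⟧ b wb)
      (absorb (columns a) sub (E3ᶜ (columns a) (columns b) (cast (sym (⟦columns⟧ a wa)) d)))

  Derivable : Rel Var 0ℓ → Set
  Derivable R = ∃ λ a → WF a × Γ ⊢ a × All (uncurry R) (columns a)

  Derivable-Step : ∀ {R} → Derivable (Step R) → Derivable R
  Derivable-Step {R} (a , wa , d , steps) =
    (z ++ z) ∣ (x ++ y) ,
    length-++-cong z z x y z-fits (trans z-fits x-fits) ,
    E6 {x = x} {y} {w} {z} z-fits premise ,
    subst (All (uncurry R)) (sym (zip-++ z x z-fits)) (All-++⁺ left right)
    where
    open E6Cover (E6-cover (columns a) steps)
    premise : Γ ⊢ (x ++ w) ∣ (y ++ w)
    premise = weaken wa (length-++-cong x w y w x-fits refl)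
                        (⊆-trans covers (⊆-reflexive (sym (zip-++ x y x-fits)))) d

  Derivable-Level : ∀ cs n → Derivable (Level cs n) → Derivable (Occurs cs)
  Derivable-Level cs zero    = Derivable-Step
  Derivable-Level cs (suc n) = Derivable-Level cs n ∘ Derivable-Step

  Shape⇒⊢ : ∀ {σ t} → WF σ → WF t → Γ ⊢ σ → Shape σ t → Γ ⊢ t
  Shape⇒⊢ wσ wt d (inj₁ embeds) = weaken wσ wt (All.lookup embeds) d
  Shape⇒⊢ {σ} {t} wσ wt d (inj₂ joins) =
    let n , levels  = Connected⇒Level-All joins
        a , wa , d′ , occurs = Derivable-Level (columns t) n (σ , wσ , d , levels)
    in weaken wa wt (All.lookup occurs) d′

  Yields⇒⊢ : ∀ {σ t} → WF σ → WF t → Γ ⊢ σ → Yields σ t → Γ ⊢ t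
  Yields⇒⊢ wσ wt d (inj₁ s) = Shape⇒⊢ wσ wt d s
  Yields⇒⊢ wσ wt d (inj₂ s) = E2 (Shape⇒⊢ wσ (sym wt) d s)

complete : ∀ {Γ a} → All WF Γ → WF a → Any (λ σ → Yields σ a) Γ → Γ ⊢ a
complete {Γ} wfΓ wa yields =
  let σ , σ∈Γ , σ⇝a = find yields
  in Completeness.Yields⇒⊢ Γ (All.lookup wfΓ σ∈Γ) wa (hyp σ∈Γ) σ⇝a

-- Floyd–Warshall: Via W a b says that b is reachable from a by a path whose
-- intermediate vertices all lie in W.
module _ {A : Set} (_≟ᴬ_ : DecidableEquality A) {R : Rel A 0ℓ} (R? : Decidable R) where

  Via : List A → Rel A 0ℓ
  Via []      a b = a ≡ b ⊎ R a b
  Via (v ∷ W) a b = Via W a b ⊎ (Via W a v × Via W v b)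

  via? : ∀ W → Decidable (Via W)
  via? []      a b = (a ≟ᴬ b) ⊎-dec R? a b
  via? (v ∷ W) a b = via? W a b ⊎-dec (via? W a v ×-dec via? W v b)

  Via⇒Star : ∀ W → Via W ⇒ Star R
  Via⇒Star []      (inj₁ refl)    = ε
  Via⇒Star []      (inj₂ r)       = r ◅ ε
  Via⇒Star (v ∷ W) (inj₁ p)       = Via⇒Star W p
  Via⇒Star (v ∷ W) (inj₂ (p , q)) = Via⇒Star W p ◅◅ Via⇒Star W q

  Via-refl : ∀ W → Reflexive (Via W)
  Via-refl []      = inj₁ refl
  Via-refl (v ∷ W) = inj₁ (Via-refl W)

  Via-step : ∀ W → R ⇒ Via W
  Via-step []      r = inj₂ r
  Via-step (v ∷ W) r = inj₁ (Via-step W r)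

  Via-trans : ∀ {W a m b} → m ∈ W → Via W a m → Via W m b → Via W a b
  Via-trans {v ∷ W} (here refl) p q = inj₂ (to-v p , from-v q)
    where
    to-v : ∀ {a} → Via (v ∷ W) a v → Via W a v
    to-v (inj₁ p)       = p
    to-v (inj₂ (p , _)) = p
    from-v : ∀ {b} → Via (v ∷ W) v b → Via W v b
    from-v (inj₁ q)       = q
    from-v (inj₂ (_ , q)) = q
  Via-trans (there m) (inj₁ p)         (inj₁ q)         = inj₁ (Via-trans m p q)
  Via-trans (there m) (inj₁ p)         (inj₂ (q₁ , q₂)) = inj₂ (Via-trans m p q₁ , q₂)
  Via-trans (there m) (inj₂ (p₁ , p₂)) (inj₁ q)         = inj₂ (p₁ , Via-trans m p₂ q)
  Via-trans (there m) (inj₂ (p₁ , _))  (inj₂ (_ , q₂))  = inj₂ (p₁ , q₂)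

  Star? : (U : List A) → (∀ {a b} → R a b → b ∈ U) → Decidable (Star R)
  Star? U R⊆U a b = map′ (Via⇒Star U) Star⇒Via (via? U a b)
    where
    Star⇒Via : Star R ⇒ Via U
    Star⇒Via ε       = Via-refl U
    Star⇒Via (r ◅ p) = Via-trans (R⊆U r) (Via-step U r) (Star⇒Via p)

_≟ᶜ_ : DecidableEquality Column
_≟ᶜ_ = ≡-dec _≟_ _≟_

open DecMembership _≟ᶜ_ using (_∈?_)

linked? : ∀ cs → Decidable (Linked (Occurs cs))
linked? cs p q = map′ from-hub to-hub (any? hub? cs)
  where
  Hub : Column → Set
  Hub c = Occurs cs (proj₁ c) p × Occurs cs (proj₁ c) q
  hub? : ∀ c → Dec (Hub c)
  hub? c = ((proj₁ c , p) ∈? cs) ×-dec ((proj₁ c , q) ∈? cs)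
  from-hub : Any Hub cs → Linked (Occurs cs) p q
  from-hub any = let _ , _ , cp , cq = find any in linked cp cq
  to-hub : Linked (Occurs cs) p q → Any Hub cs
  to-hub (linked zp zq) = lose zp (zp , zq)

connected? : ∀ cs → Decidable (Connected cs)
connected? cs = Star? _≟_ (linked? cs) (map proj₂ cs) (Linked-target cs)

shape? : ∀ σ a → Dec (Shape σ a)
shape? σ a = all? (_∈? columns a) (columns σ)
      ⊎-dec all? (λ c → connected? (columns a) (proj₁ c) (proj₂ c)) (columns σ)

yields? : ∀ σ a → Dec (Yields σ a)
yields? σ a = shape? σ a ⊎-dec shape? σ (mirror a)

Yields⇔⊢ : ∀ {Γ a} → All WF Γ → WF a → Any (λ σ → Yields σ a) Γ ⇔ Γ ⊢ a
Yields⇔⊢ wfΓ wa = mk⇔ (complete wfΓ wa) (sound wfΓ)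

theorem2 : (Σ : List Atom) (x y : Tuple) → All WF Σ → WF (x ∣ y) → Dec (Σ ⊢ x ∣ y)
theorem2 Γ x y wfΓ wf = Dec.map (Yields⇔⊢ wfΓ wf) (any? (λ σ → yields? σ (x ∣ y)) Γ)
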